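{- Let $n \geq 2$ and let $K_n$ be the complete graph on $n$ vertices. Then $\chi_s(S(K_n)) = n+1$.
   Context: All graphs are finite, simple and undirected. A star coloring of a graph $G$ is a proper vertex coloring of $G$ in which every path on four vertices uses at least three distinct colors (equivalently, the union of any two color classes induces a subgraph whose connected components are stars). The star chromatic number $\chi_s(G)$ is the least number of colors in a star coloring of $G$. The splitting graph $S(G)$ of a graph $G$ is obtained from $G$ by adding, for each vertex $v$ of $G$, a new vertex $v'$ whose neighborhood is $N(v')=N(v)$, the neighborhood of $v$ in $G$ (so $v'$ is adjacent exactly to the vertices of $G$ adjacent to $v$; the new vertices are pairwise nonadjacent). -}

module Defs where

open import Data.Nat using (ℕ; _≤_)
open import Data.Fin using (Fin)
open import Data.Sum using (_⊎_; inj₁; inj₂)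
open import Data.Product using (Σ; _×_; ∃; ∃-syntax)
open import Data.Empty using (⊥)
open import Relation.Nullary using (¬_)
open import Relation.Binary.PropositionalEquality using (_≡_; _≢_)

record Graph : Set₁ where
  field
    V     : Set
    Adj   : V → V → Set
    sym   : ∀ {u v} → Adj u v → Adj v u
    irrefl : ∀ {u} → ¬ Adj u u
open Graph public

K : ℕ → Graph
K n = record
  { V = Fin n
  ; Adj = λ u v → u ≢ v
  ; sym = λ p q → p (Relation.Binary.PropositionalEquality.sym q)
  ; irrefl = λ p → p Relation.Binary.PropositionalEquality.refl
  }

-- Splitting graph S(G): vertices V ⊎ V, inj₁ v = original v, inj₂ v = the copy v'.
SAdj : (G : Graph) → V G ⊎ V G → V G ⊎ V G → Set
SAdj G (inj₁ u) (inj₁ v) = Adj G u v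
SAdj G (inj₁ u) (inj₂ v) = Adj G v u
SAdj G (inj₂ u) (inj₁ v) = Adj G u v
SAdj G (inj₂ u) (inj₂ v) = ⊥

SAdj-sym : (G : Graph) → ∀ {x y} → SAdj G x y → SAdj G y x
SAdj-sym G {inj₁ u} {inj₁ v} p = sym G p
SAdj-sym G {inj₁ u} {inj₂ v} p = p
SAdj-sym G {inj₂ u} {inj₁ v} p = p
SAdj-sym G {inj₂ u} {inj₂ v} ()

SAdj-irrefl : (G : Graph) → ∀ {x} → ¬ SAdj G x x
SAdj-irrefl G {inj₁ u} p = irrefl G p
SAdj-irrefl G {inj₂ u} ()

S : Graph → Graph
S G = record { V = V G ⊎ V G ; Adj = SAdj G ; sym = λ {x} {y} → SAdj-sym G {x} {y} ; irrefl = λ {x} → SAdj-irrefl G {x} }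

IsP4 : (G : Graph) → V G → V G → V G → V G → Set
IsP4 G a b c d =
  (a ≢ b) × (a ≢ c) × (a ≢ d) × (b ≢ c) × (b ≢ d) × (c ≢ d) ×
  Adj G a b × Adj G b c × Adj G c d

AtLeastThreeColors : {C : Set} → C → C → C → C → Set
AtLeastThreeColors {C} p q r s =
  ∃[ x ] ∃[ y ] ∃[ z ] (x ∈4 × y ∈4 × z ∈4 × x ≢ y × x ≢ z × y ≢ z)
  where
    _∈4 : C → Set
    x ∈4 = (x ≡ p) ⊎ (x ≡ q) ⊎ (x ≡ r) ⊎ (x ≡ s)

IsStarColoring : (G : Graph) (k : ℕ) → (V G → Fin k) → Set
IsStarColoring G k col =
  (∀ u v → Adj G u v → col u ≢ col v) ×
  (∀ a b c d → IsP4 G a b c d → AtLeastThreeColors (col a) (col b) (col c) (col d))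

StarColorable : Graph → ℕ → Set
StarColorable G k = Σ (V G → Fin k) (IsStarColoring G k)

StarChromaticNumber : Graph → ℕ → Set
StarChromaticNumber G k = StarColorable G k × (∀ m → StarColorable G m → k ≤ m)

module Submission where

-- The proof rests on a reformulation of star colourings: a proper colouring
-- is a star colouring exactly when no path a–b–c–d on four vertices is
-- two-coloured, i.e. has col a = col c and col b = col d.
--
-- Upper bound (for every graph G with an injection V G → Fin n): colour each
-- original vertex by its index and every copy v' by one fresh colour.  Two
-- distinct vertices then share a colour only if both are copies, and copies
-- are pairwise nonadjacent, so no path on four vertices is two-coloured.
--
-- Lower bound: in S(K_n) a copy v' is adjacent to every original vertex
-- except v.  If some copy v' is coloured differently from v, it avoids all
-- colours of the clique K_n, so n + 1 colours are needed.  Otherwise 0' and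
-- 1' repeat the colours of 0 and 1, and 0' – 1 – 0 – 1' is a two-coloured
-- path on four vertices, which a star colouring forbids.

open import Defs
open import Data.Nat using (ℕ; _≤_; suc; s≤s; z≤n)
open import Data.Fin using (Fin; inject₁; fromℕ; _≟_) renaming (zero to fz; suc to fs)
open import Data.Fin.Properties using (fromℕ≢inject₁; inject₁-injective; injective⇒≤)
open import Data.Sum using (_⊎_; inj₁; inj₂)
open import Data.Product using (_×_; _,_; proj₁; proj₂)
open import Data.Empty using (⊥; ⊥-elim)
open import Data.Unit using (⊤; tt)
open import Function.Definitions using (Injective)
open import Relation.Nullary using (¬_; yes; no)
open import Relation.Binary.PropositionalEquality
  using (_≡_; _≢_; refl; trans; cong; subst; subst₂) renaming (sym to ≡-sym)

threeColoursUnlessAlternating : ∀ {k} (p q r s : Fin k) →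
  p ≢ q → q ≢ r → r ≢ s → ¬ (p ≡ r × q ≡ s) → AtLeastThreeColors p q r s
threeColoursUnlessAlternating p q r s p≢q q≢r r≢s notAlt with p ≟ r
... | no p≢r = p , q , r , inj₁ refl , inj₂ (inj₁ refl) , inj₂ (inj₂ (inj₁ refl)) , p≢q , p≢r , q≢r
... | yes p≡r with q ≟ s
...   | no q≢s = q , r , s , inj₂ (inj₁ refl) , inj₂ (inj₂ (inj₁ refl)) , inj₂ (inj₂ (inj₂ refl)) , q≢r , q≢s , r≢s
...   | yes q≡s = ⊥-elim (notAlt (p≡r , q≡s))

alternatingTwoColours : ∀ {C : Set} (c₀ c₁ : C) → ¬ AtLeastThreeColors c₀ c₁ c₀ c₁
alternatingTwoColours {C} c₀ c₁ (x , y , z , x∈ , y∈ , z∈ , x≢y , x≢z , y≢z) =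
  pigeonhole (oneOfTwo x∈) (oneOfTwo y∈) (oneOfTwo z∈)
  where
    oneOfTwo : ∀ {w : C} → (w ≡ c₀) ⊎ (w ≡ c₁) ⊎ (w ≡ c₀) ⊎ (w ≡ c₁) → (w ≡ c₀) ⊎ (w ≡ c₁)
    oneOfTwo (inj₁ e)               = inj₁ e
    oneOfTwo (inj₂ (inj₁ e))        = inj₂ e
    oneOfTwo (inj₂ (inj₂ (inj₁ e))) = inj₁ e
    oneOfTwo (inj₂ (inj₂ (inj₂ e))) = inj₂ e

    pigeonhole : (x ≡ c₀) ⊎ (x ≡ c₁) → (y ≡ c₀) ⊎ (y ≡ c₁) → (z ≡ c₀) ⊎ (z ≡ c₁) → ⊥
    pigeonhole (inj₁ a) (inj₁ b) _        = x≢y (trans a (≡-sym b))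
    pigeonhole (inj₂ a) (inj₂ b) _        = x≢y (trans a (≡-sym b))
    pigeonhole (inj₁ a) _        (inj₁ c) = x≢z (trans a (≡-sym c))
    pigeonhole (inj₂ a) _        (inj₂ c) = x≢z (trans a (≡-sym c))
    pigeonhole _        (inj₁ b) (inj₁ c) = y≢z (trans b (≡-sym c))
    pigeonhole _        (inj₂ b) (inj₂ c) = y≢z (trans b (≡-sym c))

Proper : (G : Graph) {k : ℕ} → (V G → Fin k) → Set
Proper G col = ∀ u v → Adj G u v → col u ≢ col v

TwoColouredP4 : (G : Graph) {k : ℕ} → (V G → Fin k) → V G → V G → V G → V G → Set
TwoColouredP4 G col a b c d = IsP4 G a b c d × col a ≡ col c × col b ≡ col d

noTwoColouredP4⇒star : (G : Graph) {k : ℕ} (col : V G → Fin k) → Proper G col →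
  (∀ a b c d → ¬ TwoColouredP4 G col a b c d) → IsStarColoring G k col
noTwoColouredP4⇒star G col proper noP4 = proper , λ a b c d p4@(_ , _ , _ , _ , _ , _ , ab , bc , cd) →
  threeColoursUnlessAlternating (col a) (col b) (col c) (col d)
    (proper a b ab) (proper b c bc) (proper c d cd)
    (λ (a~c , b~d) → noP4 a b c d (p4 , a~c , b~d))

star⇒noTwoColouredP4 : (G : Graph) {k : ℕ} (col : V G → Fin k) → IsStarColoring G k col →
  ∀ a b c d → ¬ TwoColouredP4 G col a b c d
star⇒noTwoColouredP4 G col (_ , star) a b c d (p4 , a~c , b~d) =
  alternatingTwoColours (col a) (col b)
    (subst₂ (AtLeastThreeColors (col a) (col b)) (≡-sym a~c) (≡-sym b~d) (star a b c d p4))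

IsCopy : {G : Graph} → V (S G) → Set
IsCopy (inj₁ _) = ⊥
IsCopy (inj₂ _) = ⊤

copiesNonadjacent : (G : Graph) (x y : V (S G)) → IsCopy {G} x → IsCopy {G} y → ¬ Adj (S G) x y
copiesNonadjacent G (inj₂ _) (inj₂ _) _ _ ()

adjacent⇒distinct : (G : Graph) {u v : V G} → Adj G u v → u ≢ v
adjacent⇒distinct G {u} uv u≡v = irrefl G (subst (Adj G u) (≡-sym u≡v) uv)

module FreshCopyColouring (G : Graph) {n : ℕ} (ι : V G → Fin n) (ι-inj : Injective _≡_ _≡_ ι) where

  col : V (S G) → Fin (suc n)
  col (inj₁ v) = inject₁ (ι v)
  col (inj₂ _) = fromℕ n

  sameColour⇒copies : ∀ x y → x ≢ y → col x ≡ col y → IsCopy {G} x × IsCopy {G} y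
  sameColour⇒copies (inj₁ u) (inj₁ v) x≢y e = ⊥-elim (x≢y (cong inj₁ (ι-inj (inject₁-injective e))))
  sameColour⇒copies (inj₁ u) (inj₂ v) _   e = ⊥-elim (fromℕ≢inject₁ (≡-sym e))
  sameColour⇒copies (inj₂ u) (inj₁ v) _   e = ⊥-elim (fromℕ≢inject₁ e)
  sameColour⇒copies (inj₂ u) (inj₂ v) _   _ = tt , tt

  proper : Proper (S G) col
  proper x y xy e = copiesNonadjacent G x y (proj₁ copies) (proj₂ copies) xy
    where
      copies : IsCopy {G} x × IsCopy {G} y
      copies = sameColour⇒copies x y (adjacent⇒distinct (S G) xy) e

  -- In a two-coloured path a–b–c–d both a and b would be copies, yet adjacent.
  star : IsStarColoring (S G) (suc n) col
  star = noTwoColouredP4⇒star (S G) col proper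
    λ { a b c d ((_ , a≢c , _ , _ , b≢d , _ , ab , _) , a~c , b~d) →
        copiesNonadjacent G a b (proj₁ (sameColour⇒copies a c a≢c a~c))
                                (proj₁ (sameColour⇒copies b d b≢d b~d)) ab }

upperBound : (n : ℕ) → StarColorable (S (K n)) (suc n)
upperBound n = col , star
  where open FreshCopyColouring (K n) (λ i → i) (λ e → e)

cliqueWithAvoidingVertex : (G : Graph) {m n : ℕ} (col : V G → Fin m) → Proper G col →
  (κ : Fin n → V G) → (∀ i j → i ≢ j → Adj G (κ i) (κ j)) →
  (w : V G) → (∀ i → col w ≢ col (κ i)) → suc n ≤ m
cliqueWithAvoidingVertex G col proper κ clique w avoids = injective⇒≤ f-injective
  where
    f : Fin (suc _) → Fin _
    f fz     = col w
    f (fs i) = col (κ i)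

    f-injective : Injective _≡_ _≡_ f
    f-injective {fz}   {fz}   _ = refl
    f-injective {fz}   {fs j} e = ⊥-elim (avoids j e)
    f-injective {fs i} {fz}   e = ⊥-elim (avoids i (≡-sym e))
    f-injective {fs i} {fs j} e with i ≟ j
    ... | yes i≡j = cong fs i≡j
    ... | no  i≢j = ⊥-elim (proper (κ i) (κ j) (clique i j i≢j) e)

-- A copy v' coloured differently from v avoids every colour of the original
-- clique, since v' is adjacent to all other original vertices.
copyColouredApart⇒bound : ∀ {n m} (col : V (S (K n)) → Fin m) → Proper (S (K n)) col →
  (v : Fin n) → col (inj₂ v) ≢ col (inj₁ v) → suc n ≤ m
copyColouredApart⇒bound {n} col proper v apart =
  cliqueWithAvoidingVertex (S (K n)) col proper inj₁ (λ _ _ i≢j → i≢j) (inj₂ v) avoids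
  where
    avoids : ∀ i → col (inj₂ v) ≢ col (inj₁ i)
    avoids i with v ≟ i
    ... | yes refl = apart
    ... | no  v≢i  = proper (inj₂ v) (inj₁ i) v≢i

crossPath : (k : ℕ) → IsP4 (S (K (suc (suc k)))) (inj₂ fz) (inj₁ (fs fz)) (inj₁ fz) (inj₂ (fs fz))
crossPath k = (λ ()) , (λ ()) , (λ ()) , (λ ()) , (λ ()) , (λ ()) , (λ ()) , (λ ()) , (λ ())

lowerBound : (k m : ℕ) → StarColorable (S (K (suc (suc k)))) m → suc (suc (suc k)) ≤ m
lowerBound k m (col , isStar@(proper , _))
  with col (inj₂ fz) ≟ col (inj₁ fz) | col (inj₂ (fs fz)) ≟ col (inj₁ (fs fz))
... | no apart₀ | _         = copyColouredApart⇒bound col proper fz apart₀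
... | yes _     | no apart₁ = copyColouredApart⇒bound col proper (fs fz) apart₁
... | yes same₀ | yes same₁ =
  ⊥-elim (star⇒noTwoColouredP4 (S (K (suc (suc k)))) col isStar _ _ _ _
           (crossPath k , same₀ , ≡-sym same₁))

theorem2 : (n : ℕ) → 2 ≤ n → StarChromaticNumber (S (K n)) (suc n)
theorem2 (suc (suc k)) (s≤s (s≤s z≤n)) = upperBound (suc (suc k)) , lowerBound k
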